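{- For every non-empty finite globular set $G$ that is $\triangleleft$-linear (for all elements $x,y$: $x\neq y$ iff $x\triangleleft y$ or $y\triangleleft x$), there exists a unique ps-context $\Gamma$ such that $V\Gamma=G$.
   Context: A globular set is a family of sets $(G_n)_{n\in\mathbb N}$ with maps $s,t:G_{n+1}\to G_n$ such that $s\circ s=s\circ t$ and $t\circ s=t\circ t$; it is finite if it has finitely many elements in total. $\triangleleft$ is the transitive closure of the relation generated by $s(x)\triangleleft x\triangleleft t(x)$. Contexts are lists $(x_1:A_1,\dots,x_n:A_n)$ of distinct variables with types $\star$ or $y\to_A z$ ($y,z$ variables), $\dim\star=-1$, $\dim(y\to_Az)=\dim A+1$; $V\Gamma$ is the globular set with $(V\Gamma)_n=\{x_i:\dim A_i=n-1\}$ and $s(x)=y$, $t(x)=z$ for $x:y\to_Az$. Ps-contexts: $(x:\star)\vdash_{ps}x:\star$; from $\Gamma\vdash_{ps}f:x\to_Ay$ infer $\Gamma\vdash_{ps}y:A$; from $\Gamma\vdash_{ps}x:A$ infer $(\Gamma,y:A,f:x\to_Ay)\vdash_{ps}f:x\to_Ay$ when $y,f\notin\mathrm{Var}\Gamma$; from $\Gamma\vdash_{ps}x:\star$ infer $\Gamma\vdash_{ps}$; a ps-context is a $\Gamma$ with $\Gamma\vdash_{ps}$. -}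

module Defs where

open import Data.Nat using (ℕ; zero; suc)
open import Data.Fin using (Fin)
open import Data.Product using (Σ; _×_; _,_; proj₁; ∃)
open import Data.Sum using (_⊎_)
open import Function.Bundles using (_↔_; _⇔_)
open import Relation.Nullary using (¬_)
open import Relation.Binary.PropositionalEquality using (_≡_; _≢_)
open import Relation.Binary.Construct.Closure.Transitive using (TransClosure)

record GlobSet : Set₁ where
  field
    Cells : ℕ → Set
    src   : ∀ {n} → Cells (suc n) → Cells n
    tgt   : ∀ {n} → Cells (suc n) → Cells n
    ss≡st : ∀ {n} (x : Cells (suc (suc n))) → src (src x) ≡ src (tgt x)
    ts≡tt : ∀ {n} (x : Cells (suc (suc n))) → tgt (src x) ≡ tgt (tgt x)

open GlobSet public

Elem : GlobSet → Set
Elem G = Σ ℕ (Cells G)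

FiniteGS : GlobSet → Set
FiniteGS G = Σ ℕ λ k → Elem G ↔ Fin k

NonEmptyGS : GlobSet → Set
NonEmptyGS G = Elem G

data Step (G : GlobSet) : Elem G → Elem G → Set where
  s◁ : ∀ {n} (x : Cells G (suc n)) → Step G (n , src G x) (suc n , x)
  ◁t : ∀ {n} (x : Cells G (suc n)) → Step G (suc n , x) (n , tgt G x)

◁ : (G : GlobSet) → Elem G → Elem G → Set
◁ G x y = TransClosure (Step G) x y

◁-Linear : GlobSet → Set
◁-Linear G = ∀ (x y : Elem G) → (x ≢ y) ⇔ (◁ G x y ⊎ ◁ G y x)

data Ty (X : Set) : Set where
  ⋆      : Ty X
  _⇒[_]_ : X → Ty X → X → Ty X

-- dim A + 1  (so that dim ⋆ = -1 corresponds to 0)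
dim+1 : ∀ {X} → Ty X → ℕ
dim+1 ⋆            = zero
dim+1 (y ⇒[ A ] z) = suc (dim+1 A)

data Ctx (X : Set) : Set where
  ∅     : Ctx X
  _,_∶_ : Ctx X → X → Ty X → Ctx X

infixl 5 _,_∶_

data _∶_∈_ {X : Set} : X → Ty X → Ctx X → Set where
  here  : ∀ {Γ x A} → x ∶ A ∈ (Γ , x ∶ A)
  there : ∀ {Γ x A y B} → x ∶ A ∈ Γ → x ∶ A ∈ (Γ , y ∶ B)

_∈Var_ : ∀ {X} → X → Ctx X → Set
x ∈Var Γ = ∃ λ A → x ∶ A ∈ Γ

data _⊢ps_∶_ {X : Set} : Ctx X → X → Ty X → Set where
  pss : ∀ x → (∅ , x ∶ ⋆) ⊢ps x ∶ ⋆
  psd : ∀ {Γ f x y A} → Γ ⊢ps f ∶ (x ⇒[ A ] y) → Γ ⊢ps y ∶ A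
  pse : ∀ {Γ x A} y f → Γ ⊢ps x ∶ A →
        ¬ (y ∈Var Γ) → ¬ (f ∈Var Γ) → y ≢ f →
        (Γ , y ∶ A , f ∶ (x ⇒[ A ] y)) ⊢ps f ∶ (x ⇒[ A ] y)

data _⊢ps {X : Set} (Γ : Ctx X) : Set where
  ps : ∀ {x} → Γ ⊢ps x ∶ ⋆ → Γ ⊢ps

-- V Γ = G, for a context whose variables are the elements of G.
-- (V Γ)_n = { x_i | dim A_i = n - 1 }, s(x) = y, t(x) = z for x : y →_A z.

SrcTgtAgree : (G : GlobSet) → Elem G → Ty (Elem G) → Set
SrcTgtAgree G (zero  , g) A = A ≡ ⋆
SrcTgtAgree G (suc n , g) A =
  Σ (Ty (Elem G)) λ B → A ≡ ((n , src G g) ⇒[ B ] (n , tgt G g))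

record VEq (G : GlobSet) (Γ : Ctx (Elem G)) : Set where
  field
    complete : ∀ (e : Elem G) → e ∈Var Γ
    dims     : ∀ {e A} → e ∶ A ∈ Γ → dim+1 A ≡ proj₁ e
    srctgt   : ∀ {e A} → e ∶ A ∈ Γ → SrcTgtAgree G e A

-- A ps-derivation visits the variables of its context in strictly ◁-increasing order, ending at
-- the variable it types. When ◁ is acyclic and the context exhausts G, this visiting order is
-- therefore the ◁-order of G, and the derivation, hence the context, is recovered from it.
-- For existence one walks up the finite linear order ◁ from its least element (necessarily
-- a 0-cell), one immediate successor at a time. An immediate successor is a single generating
-- step: either the target of the current cell, which is derived by the rule psd, or a cell whose
-- source is the current cell, which is added together with its target by the rule pse.
module Submission where

open import Defs

open import Level using (Level)
open import Data.Empty using (⊥)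
open import Data.Fin using (Fin)
open import Data.Fin.Induction using (spo-wellFounded)
open import Data.Fin.Properties using (any?; inj⇒≟)
open import Data.List using (List; []; _∷_)
open import Data.List.Membership.Propositional using (_∈_)
open import Data.List.Properties using (∷-injective)
open import Data.List.Relation.Binary.Subset.Propositional using (_⊆_)
open import Data.List.Relation.Unary.All as All using ()
open import Data.List.Relation.Unary.AllPairs using (AllPairs; []; _∷_)
open import Data.List.Relation.Unary.Any using (here; there)
open import Data.List.Relation.Unary.Linked using (Linked; [-]; _∷_)
open import Data.List.Relation.Unary.Linked.Properties using (Linked⇒AllPairs)
open import Data.Nat as ℕ using (suc)
open import Data.Nat.Properties using (≤-reflexive; m≤n⇒m≤1+n; m+1+n≢n; <⇒≱)
open import Data.Product using (Σ; ∃; _×_; _,_; proj₁; proj₂)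
open import Data.Sum using (_⊎_; inj₁; inj₂)
open import Data.Unit using (⊤; tt)
open import Function using (flip; _∘_)
open import Function.Bundles using (_↔_; Inverse; Equivalence)
open import Function.Properties.Inverse using (↔⇒↣)
open import Induction.WellFounded using (WellFounded; Acc; acc; module Subrelation)
open import Relation.Binary.Core using (Rel)
open import Relation.Binary.Definitions using (Asymmetric; Irreflexive; Trichotomous; tri<; tri≈; tri>)
open import Relation.Binary.Structures using (IsStrictPartialOrder; IsStrictTotalOrder)
open import Relation.Binary.Construct.Closure.Transitive using ([_]; _∷_; _++_)
import Relation.Binary.Construct.Flip.EqAndOrd as Flip
import Relation.Binary.Construct.On as On
import Relation.Binary.Construct.StrictToNonStrict as StrictToNonStrict
open import Relation.Binary.PropositionalEquality
  using (_≡_; _≢_; refl; sym; trans; cong; subst; subst₂; isEquivalence; resp₂)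
open import Relation.Nullary using (¬_; Dec; yes; no; contradiction)
open import Relation.Nullary.Decidable using (map′; _×-dec_)
open import Relation.Unary using (Pred; Decidable)
open import Relation.Unary.Properties using (U?)

private
  variable
    a ℓ ℓ′ p : Level

finite-spo-wellFounded : ∀ {A : Set a} {_≈_ : Rel A ℓ} {_<_ : Rel A ℓ′} {k} →
  A ↔ Fin k → IsStrictPartialOrder _≈_ _<_ → WellFounded _<_
finite-spo-wellFounded {_<_ = _<_} enum spo =
  Subrelation.wellFounded via-Fin
    (On.wellFounded to (spo-wellFounded (On.isStrictPartialOrder from spo)))
  where
  open Inverse enum using (to; from; strictlyInverseʳ)
  via-Fin : ∀ {x y} → x < y → from (to x) < from (to y)
  via-Fin = subst₂ _<_ (sym (strictlyInverseʳ _)) (sym (strictlyInverseʳ _))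

private
  heads-equal : ∀ {A : Set a} {R : Rel A ℓ} → Asymmetric R → ∀ {x y xs ys} →
    All.All (R x) xs → All.All (R y) ys → x ∈ y ∷ ys → y ∈ x ∷ xs → x ≡ y
  heads-equal _ _ _ (here x≡y) _ = x≡y
  heads-equal _ _ _ (there _) (here y≡x) = sym y≡x
  heads-equal asym Rx Ry (there x∈ys) (there y∈xs) =
    contradiction (All.lookup Ry x∈ys) (asym (All.lookup Rx y∈xs))
  ⊆-tail : ∀ {A : Set a} {R : Rel A ℓ} → Asymmetric R → ∀ {x xs ys} →
    All.All (R x) xs → x ∷ xs ⊆ x ∷ ys → xs ⊆ ys
  ⊆-tail asym Rx sub z∈xs with sub (there z∈xs)
  ... | there z∈ys = z∈ys
  ... | here refl = contradiction (All.lookup Rx z∈xs) (λ Rxx → asym Rxx Rxx)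

AllPairs-⊆-antisym : ∀ {A : Set a} {R : Rel A ℓ} → Asymmetric R →
  ∀ {xs ys} → AllPairs R xs → AllPairs R ys → xs ⊆ ys → ys ⊆ xs → xs ≡ ys
AllPairs-⊆-antisym asym [] [] _ _ = refl
AllPairs-⊆-antisym asym [] (_ ∷ _) _ ys⊆[] with ys⊆[] (here refl)
... | ()
AllPairs-⊆-antisym asym (_ ∷ _) [] xs⊆[] _ with xs⊆[] (here refl)
... | ()
AllPairs-⊆-antisym asym {x ∷ _} (Rx ∷ xs↓) (Ry ∷ ys↓) xs⊆ys ys⊆xs
  with heads-equal asym Rx Ry (xs⊆ys (here refl)) (ys⊆xs (here refl))
... | refl =
  cong (x ∷_) (AllPairs-⊆-antisym asym xs↓ ys↓ (⊆-tail asym Rx xs⊆ys) (⊆-tail asym Ry ys⊆xs))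

module FiniteStrictTotalOrder {A : Set a} {_<_ : Rel A ℓ}
  (sto : IsStrictTotalOrder _≡_ _<_) {k} (enum : A ↔ Fin k) where

  open IsStrictTotalOrder sto
    using (isStrictPartialOrder; compare; irrefl; <-respˡ-≈; _<?_) renaming (trans to <-trans)
  open StrictToNonStrict _≡_ _<_ public using (_≤_)
  open Inverse enum using (to; from; strictlyInverseʳ)

  ≤-<-trans : ∀ {x y z} → x ≤ y → y < z → x < z
  ≤-<-trans = StrictToNonStrict.≤-<-trans _≡_ _<_ sym <-trans <-respˡ-≈

  <-wellFounded : WellFounded _<_
  <-wellFounded = finite-spo-wellFounded enum isStrictPartialOrder

  >-wellFounded : WellFounded (flip _<_)
  >-wellFounded = finite-spo-wellFounded enum (Flip.isStrictPartialOrder isStrictPartialOrder)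

  ∃? : {P : Pred A p} → Decidable P → Dec (∃ P)
  ∃? {P = P} P? =
    map′ (λ (i , Pi) → from i , Pi) (λ (x , Px) → to x , subst P (sym (strictlyInverseʳ x)) Px)
      (any? (P? ∘ from))

  Least : Pred A p → Pred A _
  Least P s = P s × (∀ {e} → P e → s ≤ e)

  least : {P : Pred A p} → Decidable P → ∀ {w} → P w → ∃ (Least P)
  least {P = P} P? = descend (<-wellFounded _)
    where
    descend : ∀ {w} → Acc _<_ w → P w → ∃ (Least P)
    descend {w} (acc smaller) Pw with ∃? (λ x → P? x ×-dec x <? w)
    ... | yes (x , Px , x<w) = descend (smaller x<w) Px
    ... | no ∄smaller = w , Pw , below
      where
      below : ∀ {e} → P e → w ≤ e
      below {e} Pe with compare w e
      ... | tri< w<e _ _ = inj₁ w<e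
      ... | tri≈ _ w≡e _ = inj₂ w≡e
      ... | tri> _ _ e<w = contradiction (e , Pe , e<w) ∄smaller

  <-successor⇒≤ : ∀ {c s e} → Least (c <_) s → e < s → e ≤ c
  <-successor⇒≤ {c} {e = e} (_ , least-above) e<s with compare e c
  ... | tri< e<c _ _ = inj₁ e<c
  ... | tri≈ _ e≡c _ = inj₂ e≡c
  ... | tri> _ _ c<e = contradiction (≤-<-trans (least-above c<e) e<s) (irrefl refl)

  maximal⇒≤ : ∀ {c} → (∀ {e} → ¬ c < e) → ∀ e → e ≤ c
  maximal⇒≤ {c} maximal e with compare e c
  ... | tri< e<c _ _ = inj₁ e<c
  ... | tri≈ _ e≡c _ = inj₂ e≡c
  ... | tri> _ _ c<e = contradiction c<e maximal

private
  variable
    X : Set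
    Γ Γ₁ Γ₂ : Ctx X
    A A₁ A₂ B : Ty X
    x x₁ x₂ y : X

_∈Tgt_ : X → Ty X → Set
e ∈Tgt ⋆ = ⊥
e ∈Tgt (x ⇒[ B ] y) = e ≡ y ⊎ e ∈Tgt B

TargetsDeclared : Ctx X → Ty X → Set
TargetsDeclared Γ ⋆ = ⊤
TargetsDeclared Γ (x ⇒[ B ] y) = y ∶ B ∈ Γ × TargetsDeclared Γ B

TargetsDeclared-weaken : ∀ A → TargetsDeclared Γ A → TargetsDeclared (Γ , y ∶ B) A
TargetsDeclared-weaken ⋆ tt = tt
TargetsDeclared-weaken (_ ⇒[ A ] _) (y∶A , rest) = there y∶A , TargetsDeclared-weaken A rest

⊢ps-presup : Γ ⊢ps x ∶ A → x ∶ A ∈ Γ × TargetsDeclared Γ A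
⊢ps-presup (pss x) = here , tt
⊢ps-presup (psd D) = proj₂ (⊢ps-presup D)
⊢ps-presup (pse {A = A} _ _ D _ _ _) =
  here , there here , TargetsDeclared-weaken A (TargetsDeclared-weaken A (proj₂ (⊢ps-presup D)))

-- The variables in the order a derivation reaches them, most recent first.
visits earlier : ∀ {X} {Γ : Ctx X} {x A} → Γ ⊢ps x ∶ A → List X
visits {x = x} D = x ∷ earlier D
earlier (pss _) = []
earlier (psd D) = visits D
earlier (pse _ _ D _ _ _) = visits D

visits-cover : (D : Γ ⊢ps x ∶ A) → y ∈Var Γ → y ∈ visits D ⊎ y ∈Tgt A
visits-cover (pss _) (_ , here) = inj₁ (here refl)
visits-cover (psd D) y∈Γ with visits-cover D y∈Γ
... | inj₁ y∈D = inj₁ (there y∈D)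
... | inj₂ (inj₁ refl) = inj₁ (here refl)
... | inj₂ (inj₂ y∈A) = inj₂ y∈A
visits-cover (pse _ _ D _ _ _) (_ , here) = inj₁ (here refl)
visits-cover (pse _ _ D _ _ _) (_ , there here) = inj₂ (inj₁ refl)
visits-cover (pse _ _ D _ _ _) (_ , there (there y∶B)) with visits-cover D (_ , y∶B)
... | inj₁ y∈D = inj₁ (there y∈D)
... | inj₂ y∈A = inj₂ (inj₂ y∈A)

module _ (G : GlobSet) where

  private
    _≺_ : Rel (Elem G) _
    _≺_ = ◁ G

  PsContextOf : Set
  PsContextOf = Σ (Ctx (Elem G)) λ Γ → Γ ⊢ps × VEq G Γ

  Compatible : Ctx (Elem G) → Set
  Compatible Γ = ∀ {e A} → e ∶ A ∈ Γ → dim+1 A ≡ proj₁ e × SrcTgtAgree G e A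

  VEq⇒Compatible : VEq G Γ → Compatible Γ
  VEq⇒Compatible V e∶A = VEq.dims V e∶A , VEq.srctgt V e∶A

  Compatible-shrink : ∀ {Γ y A f B} → Compatible (Γ , y ∶ A , f ∶ B) → Compatible Γ
  Compatible-shrink compat e∶A = compat (there (there e∶A))

  ps-dim : Compatible Γ → Γ ⊢ps x ∶ A → dim+1 A ≡ proj₁ x
  ps-dim compat D = proj₁ (compat (proj₁ (⊢ps-presup D)))

  pending-dim : Compatible Γ → TargetsDeclared Γ A → x ∈Tgt A → proj₁ x ℕ.< dim+1 A
  pending-dim {A = _ ⇒[ _ ] _} compat (y∶B , _) (inj₁ refl) =
    ≤-reflexive (cong suc (sym (proj₁ (compat y∶B))))
  pending-dim {A = _ ⇒[ _ ] _} compat (_ , rest) (inj₂ x∈B) =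
    m≤n⇒m≤1+n (pending-dim compat rest x∈B)

  SrcTgtAgree-steps : ∀ {f x y} → SrcTgtAgree G f (x ⇒[ A ] y) → Step G x f × Step G f y
  SrcTgtAgree-steps {f = suc _ , g} (_ , refl) = s◁ g , ◁t g

  SrcTgtAgree-tgt-unique : ∀ {f x y x′ y′} →
    SrcTgtAgree G f (x ⇒[ A₁ ] y) → SrcTgtAgree G f (x′ ⇒[ A₂ ] y′) → y ≡ y′
  SrcTgtAgree-tgt-unique {f = suc _ , _} (_ , refl) (_ , refl) = refl

  SrcTgtAgree-src⇒tgt : ∀ {n} (g : Cells G (suc n)) →
    SrcTgtAgree G (n , src G g) A → SrcTgtAgree G (n , tgt G g) A
  SrcTgtAgree-src⇒tgt {n = ℕ.zero} g A≡⋆ = A≡⋆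
  SrcTgtAgree-src⇒tgt {n = suc n} g (B , A≡) rewrite ss≡st G g | ts≡tt G g = B , A≡

  visits-descending : Compatible Γ → (D : Γ ⊢ps x ∶ A) → Linked (flip _≺_) (visits D)
  visits-descending compat (pss _) = [-]
  visits-descending compat (psd D) =
    [ proj₂ (SrcTgtAgree-steps (proj₂ (compat (proj₁ (⊢ps-presup D))))) ]
      ∷ visits-descending compat D
  visits-descending compat (pse _ _ D _ _ _) =
    [ proj₁ (SrcTgtAgree-steps (proj₂ (compat here))) ]
      ∷ visits-descending (Compatible-shrink compat) D

  visits-injective : Compatible Γ₁ → Compatible Γ₂ →
    (D₁ : Γ₁ ⊢ps x₁ ∶ A₁) (D₂ : Γ₂ ⊢ps x₂ ∶ A₂) → visits D₁ ≡ visits D₂ →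
    Γ₁ ≡ Γ₂ × x₁ ≡ x₂ × A₁ ≡ A₂
  visits-injective _ _ (pss _) (pss _) refl = refl , refl , refl
  visits-injective compat₁ compat₂ (psd D₁) (psd D₂) eq
    with refl , eq′ ← ∷-injective eq
    with refl , refl , refl ← visits-injective compat₁ compat₂ D₁ D₂ eq′ = refl , refl , refl
  visits-injective compat₁ compat₂ (pse _ _ D₁ _ _ _) (pse _ _ D₂ _ _ _) eq
    with refl , eq′ ← ∷-injective eq
    with refl , refl , refl ←
           visits-injective (Compatible-shrink compat₁) (Compatible-shrink compat₂) D₁ D₂ eq′
    with refl ← SrcTgtAgree-tgt-unique (proj₂ (compat₁ here)) (proj₂ (compat₂ here)) =
    refl , refl , refl
  -- From the same cell, psd moves one dimension down and pse one dimension up.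
  visits-injective compat₁ compat₂ (psd D₁) D₂@(pse _ _ D₂′ _ _ _) eq
    with refl , eq′ ← ∷-injective eq
    with refl , refl , refl ← visits-injective compat₁ (Compatible-shrink compat₂) D₁ D₂′ eq′ =
    contradiction (trans (ps-dim compat₂ D₂) (sym (ps-dim compat₁ (psd D₁)))) (m+1+n≢n 1)
  visits-injective compat₁ compat₂ D₁@(pse _ _ D₁′ _ _ _) (psd D₂) eq
    with refl , eq′ ← ∷-injective eq
    with refl , refl , refl ← visits-injective (Compatible-shrink compat₁) compat₂ D₁′ D₂ eq′ =
    contradiction (trans (ps-dim compat₁ D₁) (sym (ps-dim compat₂ (psd D₂)))) (m+1+n≢n 1)

  visits-complete : VEq G Γ → (D : Γ ⊢ps x ∶ ⋆) → ∀ e → e ∈ visits D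
  visits-complete V D e with visits-cover D (VEq.complete V e)
  ... | inj₁ e∈D = e∈D

  ps-unique : Irreflexive _≡_ _≺_ → Γ₁ ⊢ps → VEq G Γ₁ → Γ₂ ⊢ps → VEq G Γ₂ → Γ₁ ≡ Γ₂
  ps-unique irrefl (ps D₁) V₁ (ps D₂) V₂ =
    proj₁ (visits-injective (VEq⇒Compatible V₁) (VEq⇒Compatible V₂) D₁ D₂
      (AllPairs-⊆-antisym (flip asym) (descending V₁ D₁) (descending V₂ D₂)
        (λ _ → visits-complete V₂ D₂ _) (λ _ → visits-complete V₁ D₁ _)))
    where
    asym : Asymmetric _≺_
    asym x≺y y≺x = irrefl refl (x≺y ++ y≺x)
    descending : VEq G Γ → (D : Γ ⊢ps x ∶ A) → AllPairs (flip _≺_) (visits D)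
    descending V D = Linked⇒AllPairs (flip _++_) (visits-descending (VEq⇒Compatible V) D)

  ◁-irrefl : ◁-Linear G → Irreflexive _≡_ _≺_
  ◁-irrefl linear {x} refl x≺x = Equivalence.from (linear x x) (inj₁ x≺x) refl

  ◁-isStrictTotalOrder : ◁-Linear G → FiniteGS G → IsStrictTotalOrder _≡_ _≺_
  ◁-isStrictTotalOrder linear (_ , enum) = record
    { isStrictPartialOrder = record
      { isEquivalence = isEquivalence
      ; irrefl = ◁-irrefl linear
      ; trans = _++_
      ; <-resp-≈ = resp₂ _≺_
      }
    ; compare = compare
    }
    where
    irr : ∀ {x} → ¬ x ≺ x
    irr = ◁-irrefl linear refl
    compare : Trichotomous _≡_ _≺_
    compare x y with inj⇒≟ (↔⇒↣ enum) x y
    ... | yes refl = tri≈ irr refl irr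
    ... | no x≢y with Equivalence.to (linear x y) x≢y
    ...   | inj₁ x≺y = tri< x≺y x≢y (λ y≺x → irr (x≺y ++ y≺x))
    ...   | inj₂ y≺x = tri> (λ x≺y → irr (x≺y ++ y≺x)) x≢y y≺x

  maximal⇒⋆ : ∀ {c} → SrcTgtAgree G c A → (∀ {e} → ¬ c ≺ e) → A ≡ ⋆
  maximal⇒⋆ {A = ⋆} _ _ = refl
  maximal⇒⋆ {A = _ ⇒[ _ ] _} agree maximal =
    contradiction [ proj₂ (SrcTgtAgree-steps agree) ] maximal

  module _ (sto : IsStrictTotalOrder _≡_ _≺_) {k} (enum : Elem G ↔ Fin k) where

    open FiniteStrictTotalOrder sto enum
    open IsStrictTotalOrder sto using (irrefl; _<?_)

    successor-step : ∀ {c s} → Least (c ≺_) s → Step G c s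
    successor-step ([ c→s ] , _) = c→s
    successor-step (c→y ∷ y≺s , least-above) =
      contradiction (≤-<-trans (least-above [ c→y ]) y≺s) (irrefl refl)

    record PsPrefix (c : Elem G) : Set where
      constructor prefix
      field
        context : Ctx (Elem G)
        type : Ty (Elem G)
        derivation : context ⊢ps c ∶ type
        compatible : Compatible context
        declared : ∀ {e} → e ∈Var context → e ≤ c ⊎ e ∈Tgt type
        visited : ∀ {e} → e ≤ c → e ∈Var context

    prefix-fresh : ∀ {c e} (P : PsPrefix c) → c ≺ e → dim+1 (PsPrefix.type P) ℕ.≤ proj₁ e →
      ¬ e ∈Var PsPrefix.context P
    prefix-fresh (prefix Γ A D compat declared _) c≺e A≤e e∈Γ with declared e∈Γ
    ... | inj₁ e≤c = irrefl refl (≤-<-trans e≤c c≺e)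
    ... | inj₂ e∈A = <⇒≱ (pending-dim compat (proj₂ (⊢ps-presup D)) e∈A) A≤e

    prefix-start : ∀ {c} → (∀ {e} → c ≤ e) → PsPrefix c
    prefix-start {suc _ , g} minimum = contradiction (≤-<-trans minimum [ s◁ g ]) (irrefl refl)
    prefix-start {c@(ℕ.zero , _)} minimum = prefix (∅ , c ∶ ⋆) ⋆ (pss c) compat declared visited
      where
      compat : Compatible (∅ , c ∶ ⋆)
      compat here = refl , refl
      declared : ∀ {e} → e ∈Var (∅ , c ∶ ⋆) → e ≤ c ⊎ e ∈Tgt ⋆
      declared (_ , here) = inj₁ (inj₂ refl)
      visited : ∀ {e} → e ≤ c → e ∈Var (∅ , c ∶ ⋆)
      visited (inj₂ refl) = ⋆ , here
      visited (inj₁ e≺c) = contradiction (≤-<-trans minimum e≺c) (irrefl refl)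

    prefix-target : ∀ {n} {g : Cells G (suc n)} →
      PsPrefix (suc n , g) → Least ((suc n , g) ≺_) (n , tgt G g) → PsPrefix (n , tgt G g)
    prefix-target {n} {g} (prefix Γ A D compat declared visited) successor
      with _ , B , refl ← compat (proj₁ (⊢ps-presup D)) =
      prefix Γ B (psd D) compat declared′ visited′
      where
      declared′ : ∀ {e} → e ∈Var Γ → e ≤ (n , tgt G g) ⊎ e ∈Tgt B
      declared′ e∈Γ with declared e∈Γ
      ... | inj₁ e≤c = inj₁ (inj₁ (≤-<-trans e≤c (proj₁ successor)))
      ... | inj₂ (inj₁ refl) = inj₁ (inj₂ refl)
      ... | inj₂ (inj₂ e∈B) = inj₂ e∈B
      visited′ : ∀ {e} → e ≤ (n , tgt G g) → e ∈Var Γ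
      visited′ (inj₂ refl) = B , proj₁ (proj₂ (⊢ps-presup D))
      visited′ (inj₁ e≺s) = visited (<-successor⇒≤ successor e≺s)

    prefix-source : ∀ {n} {g : Cells G (suc n)} →
      PsPrefix (n , src G g) → Least ((n , src G g) ≺_) (suc n , g) → PsPrefix (suc n , g)
    prefix-source {n} {g} P@(prefix Γ A D compat declared visited) successor =
      prefix Γ′ (c ⇒[ A ] t) (pse t s D t-fresh s-fresh t≢s) compat′ declared′ visited′
      where
      c t s : Elem G
      c = n , src G g
      t = n , tgt G g
      s = suc n , g
      Γ′ : Ctx (Elem G)
      Γ′ = Γ , t ∶ A , s ∶ (c ⇒[ A ] t)
      c∶A : c ∶ A ∈ Γ
      c∶A = proj₁ (⊢ps-presup D)
      dim-A : dim+1 A ≡ n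
      dim-A = proj₁ (compat c∶A)
      t-fresh : ¬ t ∈Var Γ
      t-fresh = prefix-fresh P (s◁ g ∷ [ ◁t g ]) (≤-reflexive dim-A)
      s-fresh : ¬ s ∈Var Γ
      s-fresh = prefix-fresh P [ s◁ g ] (m≤n⇒m≤1+n (≤-reflexive dim-A))
      t≢s : t ≢ s
      t≢s ()
      compat′ : Compatible Γ′
      compat′ here = cong suc dim-A , A , refl
      compat′ (there here) = dim-A , SrcTgtAgree-src⇒tgt g (proj₂ (compat c∶A))
      compat′ (there (there e∶B)) = compat e∶B
      declared′ : ∀ {e} → e ∈Var Γ′ → e ≤ s ⊎ e ∈Tgt (c ⇒[ A ] t)
      declared′ (_ , here) = inj₁ (inj₂ refl)
      declared′ (_ , there here) = inj₂ (inj₁ refl)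
      declared′ (_ , there (there e∶B)) with declared (_ , e∶B)
      ... | inj₁ e≤c = inj₁ (inj₁ (≤-<-trans e≤c (proj₁ successor)))
      ... | inj₂ e∈A = inj₂ (inj₂ e∈A)
      visited′ : ∀ {e} → e ≤ s → e ∈Var Γ′
      visited′ (inj₂ refl) = _ , here
      visited′ (inj₁ e≺s) with visited (<-successor⇒≤ successor e≺s)
      ... | B , e∶B = B , there (there e∶B)

    prefix-step : ∀ {c s} → PsPrefix c → Least (c ≺_) s → PsPrefix s
    prefix-step P successor with successor-step successor
    ... | ◁t _ = prefix-target P successor
    ... | s◁ _ = prefix-source P successor

    prefix-maximal : ∀ {c} → PsPrefix c → (∀ {e} → ¬ c ≺ e) → PsContextOf
    prefix-maximal (prefix Γ A D compat _ visited) maximal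
      with refl ← maximal⇒⋆ (proj₂ (compat (proj₁ (⊢ps-presup D)))) maximal =
      Γ , ps D , record
        { complete = λ e → visited (maximal⇒≤ maximal e)
        ; dims = λ e∶A → proj₁ (compat e∶A)
        ; srctgt = λ e∶A → proj₂ (compat e∶A)
        }

    prefix-complete : ∀ {c} → Acc (flip _≺_) c → PsPrefix c → PsContextOf
    prefix-complete {c} (acc above) P with ∃? (c <?_)
    ... | no ∄above = prefix-maximal P (λ c≺e → ∄above (_ , c≺e))
    ... | yes (_ , c≺e) with least (c <?_) c≺e
    ...   | _ , successor = prefix-complete (above (proj₁ successor)) (prefix-step P successor)

    ps-exists : Elem G → PsContextOf
    ps-exists e with least U? {e} tt
    ... | c , _ , minimum = prefix-complete (>-wellFounded c) (prefix-start (minimum tt))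

proposition4p4 : (G : GlobSet) → FiniteGS G → NonEmptyGS G → ◁-Linear G →
    Σ (Ctx (Elem G)) λ Γ → (Γ ⊢ps × VEq G Γ) ×
    (∀ (Γ′ : Ctx (Elem G)) → Γ′ ⊢ps → VEq G Γ′ → Γ′ ≡ Γ)
proposition4p4 G finite nonempty linear
  with ps-exists G (◁-isStrictTotalOrder G linear finite) (proj₂ finite) nonempty
... | Γ , Γ-ps , Γ-V =
  Γ , (Γ-ps , Γ-V) , λ _ Γ′-ps Γ′-V → ps-unique G (◁-irrefl G linear) Γ′-ps Γ′-V Γ-ps Γ-V
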